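{- Let $G$ be a group with finite generating set $S$ and $\Gamma$ a tileset graph for $(G,S)$. The following are equivalent: (1) $\Gamma$ admits a bi-infinite snake; (2) $\Gamma$ admits a one-way infinite snake (defined on $\mathbb{N}$); (3) $\Gamma$ admits a snake of every length.
   Context: A tileset graph for $(G,S)$ is a finite multigraph $\Gamma=(A,B)$ with vertex set $A$ whose edges are triples $(a,a',s)$ with $a,a'\in A$ and $s\in S\cup S^{ -1}$, such that $(a,a',s)\in B$ implies $(a',a,s^{ -1})\in B$. Let $I$ be $\mathbb{Z}$, $\mathbb{N}$, or an integer interval $\llbracket n,m\rrbracket$. A $\Gamma$-snake is a pair $(\omega,\zeta)$ with $\omega:I\to G$ injective and $\zeta:I\to A$ such that for all $i,i+1\in I$, $d\omega_i:=\omega(i)^{ -1}\omega(i+1)\in S\cup S^{ -1}$ and $(\zeta(i),\zeta(i+1),d\omega_i)\in B$. It is bi-infinite if $I=\mathbb{Z}$; its length refers to the size of a finite interval domain $I$. -}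

module Defs where

open import Level using (Level; _⊔_)
open import Algebra.Bundles using (Group)
open import Data.Nat as ℕ using (ℕ)
open import Data.Integer as ℤ using (ℤ; +_)
open import Data.Fin using (Fin)
open import Data.Bool using (Bool; true; false)
open import Data.List using (List; foldr; length; lookup)
open import Data.List.Relation.Unary.Any using (Any)
open import Data.List.Relation.Unary.All using (All)
open import Data.Product using (Σ; _×_; _,_; ∃; ∃-syntax)
open import Data.Sum using (_⊎_)
open import Relation.Binary.PropositionalEquality using (_≡_)

module Snakes {c ℓ : Level} (G : Group c ℓ) where
  open Group G

  InS± : List Carrier → Carrier → Set (c ⊔ ℓ)
  InS± S g = Any (λ s → (g ≈ s) ⊎ (g ≈ s ⁻¹)) S

  letter : (S : List Carrier) → Fin (length S) × Bool → Carrier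
  letter S (i , true)  = lookup S i
  letter S (i , false) = lookup S i ⁻¹

  Generates : List Carrier → Set (c ⊔ ℓ)
  Generates S = ∀ g → ∃[ w ] foldr (λ x acc → letter S x ∙ acc) ε w ≈ g

  -- A finite multigraph on vertex set A = Fin k, edges a list of triples (a , a' , s)
  Edges : ℕ → Set c
  Edges k = List (Fin k × Fin k × Carrier)

  EdgeIn : {k : ℕ} → Edges k → Fin k → Fin k → Carrier → Set (c ⊔ ℓ)
  EdgeIn B a a' g = Any (λ { (b , b' , t) → (b ≡ a) × (b' ≡ a') × (g ≈ t) }) B

  IsTilesetGraph : List Carrier → {k : ℕ} → Edges k → Set (c ⊔ ℓ)
  IsTilesetGraph S B =
    All (λ { (a , a' , s) → InS± S s × EdgeIn B a' a (s ⁻¹) }) B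

  d : Carrier → Carrier → Carrier
  d x y = x ⁻¹ ∙ y

  Step : List Carrier → {k : ℕ} → Edges k →
         Carrier → Carrier → Fin k → Fin k → Set (c ⊔ ℓ)
  Step S B x y a a' = InS± S (d x y) × EdgeIn B a a' (d x y)

  BiInfiniteSnake : List Carrier → {k : ℕ} → Edges k → Set (c ⊔ ℓ)
  BiInfiniteSnake S {k} B =
    Σ (ℤ → Carrier) λ ω → Σ (ℤ → Fin k) λ ζ →
      (∀ i j → ω i ≈ ω j → i ≡ j) ×
      (∀ i → Step S B (ω i) (ω (i ℤ.+ + 1)) (ζ i) (ζ (i ℤ.+ + 1)))

  OneWaySnake : List Carrier → {k : ℕ} → Edges k → Set (c ⊔ ℓ)
  OneWaySnake S {k} B =
    Σ (ℕ → Carrier) λ ω → Σ (ℕ → Fin k) λ ζ →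
      (∀ i j → ω i ≈ ω j → i ≡ j) ×
      (∀ i → Step S B (ω i) (ω (ℕ.suc i)) (ζ i) (ζ (ℕ.suc i)))

  -- snake on the integer interval ⟦lo , hi⟧ (ω, ζ given on ℤ; only values
  -- on the interval matter)
  IntervalSnake : List Carrier → {k : ℕ} → Edges k → ℤ → ℤ → Set (c ⊔ ℓ)
  IntervalSnake S {k} B lo hi =
    Σ (ℤ → Carrier) λ ω → Σ (ℤ → Fin k) λ ζ →
      (∀ i j → lo ℤ.≤ i → i ℤ.≤ hi → lo ℤ.≤ j → j ℤ.≤ hi →
         ω i ≈ ω j → i ≡ j) ×
      (∀ i → lo ℤ.≤ i → i ℤ.+ + 1 ℤ.≤ hi →
         Step S B (ω i) (ω (i ℤ.+ + 1)) (ζ i) (ζ (i ℤ.+ + 1)))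

  SnakeOfLength : List Carrier → {k : ℕ} → Edges k → ℕ → Set (c ⊔ ℓ)
  SnakeOfLength S B n =
    ∃[ lo ] ∃[ hi ] ((hi ℤ.- lo) ℤ.+ + 1 ≡ + n) × IntervalSnake S B lo hi

-- A snake of every length yields, after centring, a snake on every window
-- ⟦-n , n⟧. Normalised to start at the identity, such a window snake is
-- determined by its tiles and by the letters of S ∪ S⁻¹ read off its steps in
-- both directions from the centre, i.e. by a word over a finite alphabet.
-- Since being a window snake only depends on a finite prefix of the word,
-- König's lemma (a compactness argument, hence excluded middle) produces one
-- infinite word that is a snake on every window, i.e. a bi-infinite snake.
-- The remaining implications are restrictions.
module Submission where

open import Defs
import Algebra.Properties.Group as GroupProperties
import Algebra.Properties.Loop as LoopProperties
open import Algebra.Bundles using (Group; AbelianGroup)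
open import Axiom.DoubleNegationElimination using (em⇒dne)
open import Axiom.ExcludedMiddle using (ExcludedMiddle)
open import Data.Bool using (Bool; true; false)
open import Data.Empty using (⊥-elim)
open import Data.Fin using (Fin)
open import Data.Integer as ℤ using (ℤ; +_; -[1+_]; ∣_∣)
import Data.Integer.Properties as ℤ
open import Data.Integer.Tactic.RingSolver using (solve-∀)
open import Data.List using (List; []; _∷_; map; length; cartesianProduct; allFin)
open import Data.List.Extrema.Nat using (max; xs≤max)
open import Data.List.Membership.Propositional using (_∈_)
open import Data.List.Membership.Propositional.Properties
  using (∈-map⁺; ∈-allFin; ∈-cartesianProduct⁺)
open import Data.List.Relation.Unary.All as All using ()
open import Data.List.Relation.Unary.All.Properties as All using ()
open import Data.List.Relation.Unary.Any as Any using (here; there)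
open import Data.List.Relation.Unary.Any.Properties using (lookup-index)
open import Data.Maybe using (Maybe; nothing; just)
open import Data.Nat as ℕ using (ℕ; zero; suc; _≤_; _<_; _≤′_; ≤′-refl; ≤′-step; z≤n; s≤s)
import Data.Nat.Properties as ℕ
open import Data.Product using (_×_; ∃; ∃₂; _,_; proj₁; proj₂)
open import Data.Sum using (inj₁; inj₂)
open import Function using (_∘_; id)
open import Function.Bundles using (_⇔_; mk⇔)
open import Level using (Level; _⊔_) renaming (suc to lsuc)
open import Relation.Binary.PropositionalEquality as ≡
  using (_≡_; refl; cong; cong₂; subst)
import Relation.Binary.Reasoning.Setoid as SetoidReasoning
open import Relation.Nullary using (¬_; Dec; yes; no; contradiction)
open import Relation.Nullary.Negation using (¬∃⟶∀¬)

module König {a p} {C : Set a} (em : ExcludedMiddle (a ⊔ p))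
             (xs : List C) (xs-complete : ∀ x → x ∈ xs) where

  ¬∀⇒∃¬ : {Q : ℕ → Set (a ⊔ p)} → ¬ (∀ m → Q m) → ∃ λ m → ¬ Q m
  ¬∀⇒∃¬ ¬∀ = dne λ ¬∃ → ¬∀ λ m → dne (¬∃⟶∀¬ ¬∃ m)
    where dne = em⇒dne em

  _◃_ : C → (ℕ → C) → ℕ → C
  (x ◃ h) zero    = x
  (x ◃ h) (suc i) = h i

  record NestedCylinders : Set (a ⊔ lsuc p) where
    field
      P          : ℕ → (ℕ → C) → Set p
      P-suc⇒P    : ∀ {n f} → P (suc n) f → P n f
      P-local    : ∀ {n f g} → (∀ i → i ≤ n → f i ≡ g i) → P n f → P n g
      P-nonempty : ∀ n → ∃ (P n)

    P-≤′ : ∀ {m n f} → m ≤′ n → P n f → P m f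
    P-≤′ ≤′-refl        = id
    P-≤′ (≤′-step m≤′n) = P-≤′ m≤′n ∘ P-suc⇒P

    Extends : C → ℕ → Set (a ⊔ p)
    Extends x m = ∃ λ h → P (suc m) (x ◃ h)

    -- Otherwise every head fails beyond some level; a single level above all
    -- of them (there are finitely many heads) is then empty.
    goodHead : ∃ λ x → ∀ m → Extends x m
    goodHead with em {∃ λ x → ∀ m → Extends x m}
    ... | yes found = found
    ... | no none   = ⊥-elim (proj₂ (escape x₀)
                        (h , P-≤′ (ℕ.≤⇒≤′ (s≤s (escape≤M x₀))) (P-local g≗x₀◃h Pg)))
      where
      escape : ∀ x → ∃ λ m → ¬ Extends x m
      escape x = ¬∀⇒∃¬ λ all → none (x , all)

      M : ℕ
      M = max 0 (map (proj₁ ∘ escape) xs)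

      escape≤M : ∀ x → proj₁ (escape x) ≤ M
      escape≤M x = All.lookup (All.map⁻ (xs≤max 0 (map (proj₁ ∘ escape) xs))) (xs-complete x)

      g = proj₁ (P-nonempty (suc M))
      Pg = proj₂ (P-nonempty (suc M))
      x₀ = g 0
      h = λ i → g (suc i)

      g≗x₀◃h : ∀ i → i ≤ suc M → g i ≡ (x₀ ◃ h) i
      g≗x₀◃h zero    _ = refl
      g≗x₀◃h (suc i) _ = refl

  open NestedCylinders

  after : NestedCylinders → NestedCylinders
  after T = record
    { P          = λ m h → P T (suc m) (x ◃ h)
    ; P-suc⇒P    = P-suc⇒P T
    ; P-local    = λ agree → P-local T (◃-local agree)
    ; P-nonempty = proj₂ (goodHead T)
    }
    where
    x = proj₁ (goodHead T)
    ◃-local : ∀ {m h h'} → (∀ i → i ≤ m → h i ≡ h' i) →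
              ∀ i → i ≤ suc m → (x ◃ h) i ≡ (x ◃ h') i
    ◃-local agree zero    _         = refl
    ◃-local agree (suc i) (s≤s i≤m) = agree i i≤m

  branch : NestedCylinders → ℕ → C
  branch T zero    = proj₁ (goodHead T)
  branch T (suc i) = branch (after T) i

  branch-∈ : ∀ T n → P T n (branch T)
  branch-∈ T zero    = P-local T (λ { zero _ → refl ; (suc i) () })
                         (P-suc⇒P T (proj₂ (proj₂ (goodHead T) 0)))
  branch-∈ T (suc n) = P-local T (λ { zero _ → refl ; (suc i) _ → refl })
                         (branch-∈ (after T) n)

könig : ∀ {a p} {C : Set a} → ExcludedMiddle (a ⊔ p) →
        (xs : List C) → (∀ x → x ∈ xs) →
        (P : ℕ → (ℕ → C) → Set p) →
        (∀ {n f} → P (suc n) f → P n f) →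
        (∀ {n f g} → (∀ i → i ≤ n → f i ≡ g i) → P n f → P n g) →
        (∀ n → ∃ (P n)) →
        ∃ λ f → ∀ n → P n f
könig em xs xs-complete P P-suc⇒P P-local P-nonempty =
  branch T , branch-∈ T
  where
  open König em xs xs-complete
  T = record { P = P ; P-suc⇒P = P-suc⇒P ; P-local = P-local ; P-nonempty = P-nonempty }

glue : ∀ {a} {A : Set a} → (ℕ → A) → (ℕ → A) → ℤ → A
glue p q (+ j)     = p j
glue p q -[1+ j ] = q (suc j)

glue-halves : ∀ {a} {A : Set a} (F : ℤ → A) i → glue (F ∘ +_) (F ∘ ℤ.-_ ∘ +_) i ≡ F i
glue-halves F (+ j)     = refl
glue-halves F -[1+ j ] = refl

glue-pointwise : ∀ {a b r} {A : Set a} {B : Set b} (R : A → B → Set r) {n p q p' q'} →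
                 (∀ j → j ≤ n → R (p j) (p' j)) → (∀ j → j ≤ n → R (q j) (q' j)) →
                 ∀ i → ∣ i ∣ ≤ n → R (glue p q i) (glue p' q' i)
glue-pointwise R R-p R-q (+ j)     = R-p j
glue-pointwise R R-p R-q -[1+ j ] = R-q (suc j)

+j+1≡+suc : ∀ j → + j ℤ.+ + 1 ≡ + suc j
+j+1≡+suc j = cong +_ (ℕ.+-comm j 1)

-[1+j]+1≡-j : ∀ j → -[1+ j ] ℤ.+ + 1 ≡ ℤ.- + j
-[1+j]+1≡-j zero    = refl
-[1+j]+1≡-j (suc j) = refl

∣i∣≤n⇒-n≤i : ∀ {n} i → ∣ i ∣ ≤ n → ℤ.- + n ℤ.≤ i
∣i∣≤n⇒-n≤i {zero}  (+ j)     _         = ℤ.+≤+ z≤n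
∣i∣≤n⇒-n≤i {suc n} (+ j)     _         = ℤ.-≤+
∣i∣≤n⇒-n≤i {suc n} -[1+ j ] (s≤s j≤n) = ℤ.-≤- j≤n

∣i∣≤n⇒i≤+n : ∀ {n} i → ∣ i ∣ ≤ n → i ℤ.≤ + n
∣i∣≤n⇒i≤+n (+ j)     j≤n = ℤ.+≤+ j≤n
∣i∣≤n⇒i≤+n -[1+ j ] _   = ℤ.-≤+

i≡[i+j]-j : ∀ i j → i ≡ (i ℤ.+ j) ℤ.- j
i≡[i+j]-j = solve-∀

j≡i+[j-i+1]-1 : ∀ i j → j ≡ i ℤ.+ (j ℤ.- i ℤ.+ + 1) ℤ.- + 1
j≡i+[j-i+1]-1 = solve-∀

i+[1+j+j]-1≡i+j+j : ∀ i j → i ℤ.+ (+ 1 ℤ.+ (j ℤ.+ j)) ℤ.- + 1 ≡ i ℤ.+ j ℤ.+ j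
i+[1+j+j]-1≡i+j+j = solve-∀

i-1-0+1≡i : ∀ i → i ℤ.- + 1 ℤ.- + 0 ℤ.+ + 1 ≡ i
i-1-0+1≡i = solve-∀

+-cancelˡ : ∀ c {i j} → c ℤ.+ i ≡ c ℤ.+ j → i ≡ j
+-cancelˡ c = GroupProperties.∙-cancelˡ (AbelianGroup.group ℤ.+-0-abelianGroup) c _ _

module SnakeTheory {c ℓ : Level} (G : Group c ℓ) (S : List (Group.Carrier G))
                   {k : ℕ} (B : Snakes.Edges G k) where

  open Group G hiding (refl)
  open Snakes G using (InS±; letter; EdgeIn; Step; d; BiInfiniteSnake;
                       OneWaySnake; IntervalSnake; SnakeOfLength)
  open GroupProperties G using (⁻¹-involutive; ⁻¹-anti-homo-∙; ⁻¹-anti-homo-\\;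
                                \\-leftDividesˡ; \\-leftDividesʳ; \\-cong₂; ∙-cancelˡ; loop)
  open LoopProperties loop using (x\\x≈ε)
  open SetoidReasoning setoid

  d-trans : ∀ x y z → d x y ∙ d y z ≈ d x z
  d-trans x y z = begin
    (x ⁻¹ ∙ y) ∙ (y ⁻¹ ∙ z) ≈⟨ assoc (x ⁻¹) y (y ⁻¹ ∙ z) ⟩
    x ⁻¹ ∙ (y ∙ (y ⁻¹ ∙ z)) ≈⟨ ∙-congˡ (\\-leftDividesˡ y z) ⟩
    x ⁻¹ ∙ z                 ∎

  d-∙ˡ : ∀ a x y → d (a ∙ x) (a ∙ y) ≈ d x y
  d-∙ˡ a x y = begin
    (a ∙ x) ⁻¹ ∙ (a ∙ y)      ≈⟨ ∙-congʳ (⁻¹-anti-homo-∙ a x) ⟩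
    (x ⁻¹ ∙ a ⁻¹) ∙ (a ∙ y)   ≈⟨ assoc (x ⁻¹) (a ⁻¹) (a ∙ y) ⟩
    x ⁻¹ ∙ (a ⁻¹ ∙ (a ∙ y))   ≈⟨ ∙-congˡ (\\-leftDividesʳ a y) ⟩
    x ⁻¹ ∙ y                   ∎

  InS±-resp : ∀ {g h} → g ≈ h → InS± S g → InS± S h
  InS±-resp g≈h = Any.map λ { (inj₁ g≈s) → inj₁ (trans (sym g≈h) g≈s)
                            ; (inj₂ g≈s⁻¹) → inj₂ (trans (sym g≈h) g≈s⁻¹) }

  InS±-⁻¹ : ∀ {g} → InS± S g → InS± S (g ⁻¹)
  InS±-⁻¹ = Any.map λ { (inj₁ g≈s) → inj₂ (⁻¹-cong g≈s)
                      ; (inj₂ g≈s⁻¹) → inj₁ (trans (⁻¹-cong g≈s⁻¹) (⁻¹-involutive _)) }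

  EdgeIn-resp : ∀ {a a' g h} → g ≈ h → EdgeIn B a a' g → EdgeIn B a a' h
  EdgeIn-resp g≈h = Any.map λ { (b≡a , b'≡a' , g≈t) → b≡a , b'≡a' , trans (sym g≈h) g≈t }

  Step-resp : ∀ {x y x' y' a a'} → d x y ≈ d x' y' → Step S B x y a a' → Step S B x' y' a a'
  Step-resp e (in-S± , edge) = InS±-resp e in-S± , EdgeIn-resp e edge

  SnakeOn : (ℤ → Set) → (ℤ → Carrier) → (ℤ → Fin k) → Set (c ⊔ ℓ)
  SnakeOn D ω ζ =
    (∀ i j → D i → D j → ω i ≈ ω j → i ≡ j) ×
    (∀ i → D i → D (i ℤ.+ + 1) → Step S B (ω i) (ω (i ℤ.+ + 1)) (ζ i) (ζ (i ℤ.+ + 1)))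

  module _ {D : ℤ → Set} {ω : ℤ → Carrier} {ζ : ℤ → Fin k} where

    SnakeOn-restrict : {D' : ℤ → Set} → (∀ {i} → D' i → D i) → SnakeOn D ω ζ → SnakeOn D' ω ζ
    SnakeOn-restrict D'⊆D (inj , step) =
      (λ i j Di Dj → inj i j (D'⊆D Di) (D'⊆D Dj)) ,
      (λ i Di Di+1 → step i (D'⊆D Di) (D'⊆D Di+1))

    SnakeOn-resp : ∀ {ω' ζ'} → (∀ i → D i → ω i ≈ ω' i) → (∀ i → D i → ζ i ≡ ζ' i) →
                   SnakeOn D ω ζ → SnakeOn D ω' ζ'
    SnakeOn-resp ω≈ω' ζ≡ζ' (inj , step) =
      (λ i j Di Dj e → inj i j Di Dj (trans (ω≈ω' i Di) (trans e (sym (ω≈ω' j Dj))))) ,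
      (λ i Di Di+1 → Step-≡-tiles (ζ≡ζ' i Di) (ζ≡ζ' _ Di+1)
        (Step-resp (\\-cong₂ (ω≈ω' i Di) (ω≈ω' _ Di+1)) (step i Di Di+1)))
      where
      Step-≡-tiles : ∀ {x y a b a' b'} → a ≡ a' → b ≡ b' → Step S B x y a b → Step S B x y a' b'
      Step-≡-tiles refl refl s = s

    SnakeOn-∙ˡ : ∀ a → SnakeOn D ω ζ → SnakeOn D (λ i → a ∙ ω i) ζ
    SnakeOn-∙ˡ a (inj , step) =
      (λ i j Di Dj e → inj i j Di Dj (∙-cancelˡ a _ _ e)) ,
      (λ i Di Di+1 → Step-resp (sym (d-∙ˡ a _ _)) (step i Di Di+1))

    SnakeOn-shift : ∀ c → SnakeOn D ω ζ →
                    SnakeOn (λ i → D (c ℤ.+ i)) (λ i → ω (c ℤ.+ i)) (λ i → ζ (c ℤ.+ i))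
    SnakeOn-shift c (inj , step) =
      (λ i j Di Dj e → +-cancelˡ c (inj _ _ Di Dj e)) ,
      (λ i Di Di+1 → subst (λ t → Step S B (ω (c ℤ.+ i)) (ω t) (ζ (c ℤ.+ i)) (ζ t))
                       (ℤ.+-assoc c i (+ 1))
                       (step _ Di (subst D (≡.sym (ℤ.+-assoc c i (+ 1))) Di+1)))

  intervalSnake⇒SnakeOn : ∀ {lo hi} (snake : IntervalSnake S B lo hi) →
                          SnakeOn (λ i → lo ℤ.≤ i × i ℤ.≤ hi) (proj₁ snake) (proj₁ (proj₂ snake))
  intervalSnake⇒SnakeOn (_ , _ , inj , step) =
    (λ i j (lo≤i , i≤hi) (lo≤j , j≤hi) → inj i j lo≤i i≤hi lo≤j j≤hi) ,
    (λ i (lo≤i , _) (_ , i+1≤hi) → step i lo≤i i+1≤hi)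

  Window : ℕ → (ℤ → Carrier) → (ℤ → Fin k) → Set (c ⊔ ℓ)
  Window n = SnakeOn (λ i → ∣ i ∣ ≤ n)

  centredWindow : ∀ n → SnakeOfLength S B (suc (n ℕ.+ n)) → ∃₂ (Window n)
  centredWindow n (lo , hi , len , snake) =
    _ , _ , SnakeOn-restrict inside (SnakeOn-shift centre (intervalSnake⇒SnakeOn snake))
    where
    centre = lo ℤ.+ + n

    lo≡ : lo ≡ centre ℤ.- + n
    lo≡ = i≡[i+j]-j lo (+ n)

    hi≡ : hi ≡ centre ℤ.+ + n
    hi≡ = ≡.trans (j≡i+[j-i+1]-1 lo hi)
            (≡.trans (cong (λ l → lo ℤ.+ l ℤ.- + 1) len) (i+[1+j+j]-1≡i+j+j lo (+ n)))

    inside : ∀ {i} → ∣ i ∣ ≤ n → lo ℤ.≤ centre ℤ.+ i × centre ℤ.+ i ℤ.≤ hi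
    inside {i} ∣i∣≤n =
      ℤ.≤-trans (ℤ.≤-reflexive lo≡) (ℤ.+-monoʳ-≤ centre (∣i∣≤n⇒-n≤i i ∣i∣≤n)) ,
      ℤ.≤-trans (ℤ.+-monoʳ-≤ centre (∣i∣≤n⇒i≤+n i ∣i∣≤n)) (ℤ.≤-reflexive (≡.sym hi≡))

  windows⇒biInfinite : ∀ {ω ζ} → (∀ n → Window n ω ζ) → BiInfiniteSnake S B
  windows⇒biInfinite {ω} {ζ} window =
    ω , ζ ,
    (λ i j → proj₁ (window (∣ i ∣ ℕ.+ ∣ j ∣)) i j (ℕ.m≤m+n _ _) (ℕ.m≤n+m _ _)) ,
    (λ i → proj₂ (window (∣ i ∣ ℕ.+ 1)) i (ℕ.m≤m+n _ _) (ℤ.∣i+j∣≤∣i∣+∣j∣ i (+ 1)))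

  -- nothing is the filler letter used outside a window.
  Letter : Set
  Letter = Maybe (Fin (length S) × Bool)

  ⟦_⟧ : Letter → Carrier
  ⟦ nothing ⟧ = ε
  ⟦ just x ⟧  = letter S x

  letterOf : ∀ {g} → InS± S g → Letter
  letterOf g∈S± with lookup-index g∈S±
  ... | inj₁ _ = just (Any.index g∈S± , true)
  ... | inj₂ _ = just (Any.index g∈S± , false)

  ⟦letterOf⟧ : ∀ {g} (g∈S± : InS± S g) → ⟦ letterOf g∈S± ⟧ ≈ g
  ⟦letterOf⟧ g∈S± with lookup-index g∈S±
  ... | inj₁ g≈s   = sym g≈s
  ... | inj₂ g≈s⁻¹ = sym g≈s⁻¹

  letterIf : ∀ {A : Set} {g} → Dec A → (A → InS± S g) → Letter
  letterIf (yes a) g∈S± = letterOf (g∈S± a)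
  letterIf (no _)  _    = nothing

  ⟦letterIf⟧ : ∀ {A : Set} {g} (A? : Dec A) (g∈S± : A → InS± S g) → A → ⟦ letterIf A? g∈S± ⟧ ≈ g
  ⟦letterIf⟧ (yes a) g∈S± _ = ⟦letterOf⟧ (g∈S± a)
  ⟦letterIf⟧ (no ¬a) _    a = contradiction a ¬a

  allLetters : List Letter
  allLetters = nothing ∷ map just (cartesianProduct (allFin _) (true ∷ false ∷ []))

  ∈-allLetters : ∀ x → x ∈ allLetters
  ∈-allLetters nothing          = here refl
  ∈-allLetters (just (i , b))   = there (∈-map⁺ just (∈-cartesianProduct⁺ (∈-allFin i) (∈-Bool b)))
    where
    ∈-Bool : ∀ b → b ∈ true ∷ false ∷ []
    ∈-Bool true  = here refl
    ∈-Bool false = there (here refl)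

  prefixProduct : (ℕ → Carrier) → ℕ → Carrier
  prefixProduct u zero    = ε
  prefixProduct u (suc j) = prefixProduct u j ∙ u j

  prefixProduct-local : ∀ {u v} j → (∀ i → i < j → u i ≡ v i) → prefixProduct u j ≡ prefixProduct v j
  prefixProduct-local zero    _     = refl
  prefixProduct-local (suc j) u≡v =
    cong₂ _∙_ (prefixProduct-local j (λ i i<j → u≡v i (ℕ.m≤n⇒m≤1+n i<j))) (u≡v j ℕ.≤-refl)

  prefixProduct-telescope : ∀ {n} u (ω : ℕ → Carrier) →
                            (∀ j → suc j ≤ n → u j ≈ d (ω j) (ω (suc j))) →
                            ∀ j → j ≤ n → prefixProduct u j ≈ d (ω 0) (ω j)
  prefixProduct-telescope u ω steps zero    _   = sym (x\\x≈ε (ω 0))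
  prefixProduct-telescope u ω steps (suc j) j<n = begin
    prefixProduct u j ∙ u j             ≈⟨ ∙-cong (prefixProduct-telescope u ω steps j (ℕ.<⇒≤ j<n))
                                                   (steps j j<n) ⟩
    d (ω 0) (ω j) ∙ d (ω j) (ω (suc j)) ≈⟨ d-trans (ω 0) (ω j) (ω (suc j)) ⟩
    d (ω 0) (ω (suc j))                 ∎

  walk : (ℕ → Letter) → ℕ → Carrier
  walk l = prefixProduct (⟦_⟧ ∘ l)

  lettersOf : ∀ n (ω : ℕ → Carrier) → (∀ j → suc j ≤ n → InS± S (d (ω j) (ω (suc j)))) → ℕ → Letter
  lettersOf n ω steps j = letterIf (suc j ℕ.≤? n) (steps j)

  walk-lettersOf : ∀ {n} ω steps j → j ≤ n → walk (lettersOf n ω steps) j ≈ d (ω 0) (ω j)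
  walk-lettersOf {n} ω steps =
    prefixProduct-telescope _ ω (λ j → ⟦letterIf⟧ (suc j ℕ.≤? n) (steps j))

  -- The forward and the backward half of a centred window, each read from
  -- the centre outwards: at position j, the letter of the step j → j + 1 and
  -- the tile at j.
  Code : Set
  Code = (Letter × Fin k) × (Letter × Fin k)

  allCodes : List Code
  allCodes = cartesianProduct allCells allCells
    where allCells = cartesianProduct allLetters (allFin k)

  ∈-allCodes : ∀ x → x ∈ allCodes
  ∈-allCodes ((l , t) , (l' , t')) =
    ∈-cartesianProduct⁺ (∈-cartesianProduct⁺ (∈-allLetters l) (∈-allFin t))
                        (∈-cartesianProduct⁺ (∈-allLetters l') (∈-allFin t'))

  decodeω : (ℕ → Code) → ℤ → Carrier
  decodeω f = glue (walk (proj₁ ∘ proj₁ ∘ f)) (walk (proj₁ ∘ proj₂ ∘ f))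

  decodeζ : (ℕ → Code) → ℤ → Fin k
  decodeζ f = glue (proj₂ ∘ proj₁ ∘ f) (proj₂ ∘ proj₂ ∘ f)

  CodesWindow : ℕ → (ℕ → Code) → Set (c ⊔ ℓ)
  CodesWindow n f = Window n (decodeω f) (decodeζ f)

  CodesWindow-local : ∀ {n f g} → (∀ i → i ≤ n → f i ≡ g i) → CodesWindow n f → CodesWindow n g
  CodesWindow-local {n} {f} {g} f≡g =
    SnakeOn-resp (λ i → reflexive ∘ glue-pointwise _≡_ (walk≡ proj₁) (walk≡ proj₂) i)
                 (glue-pointwise _≡_ (tile≡ proj₁) (tile≡ proj₂))
    where
    walk≡ : (half : Code → Letter × Fin k) → ∀ j → j ≤ n →
            walk (proj₁ ∘ half ∘ f) j ≡ walk (proj₁ ∘ half ∘ g) j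
    walk≡ half j j≤n = prefixProduct-local j λ i i<j →
      cong (⟦_⟧ ∘ proj₁ ∘ half) (f≡g i (ℕ.≤-trans (ℕ.<⇒≤ i<j) j≤n))
    tile≡ : (half : Code → Letter × Fin k) → ∀ j → j ≤ n → proj₂ (half (f j)) ≡ proj₂ (half (g j))
    tile≡ half j j≤n = cong (proj₂ ∘ half) (f≡g j j≤n)

  module _ {n ω ζ} (window : Window n ω ζ) where

    private
      step : ∀ i → ∣ i ∣ ≤ n → ∣ i ℤ.+ + 1 ∣ ≤ n → InS± S (d (ω i) (ω (i ℤ.+ + 1)))
      step i Di Di+1 = proj₁ (proj₂ window i Di Di+1)

    forwardSteps : ∀ j → suc j ≤ n → InS± S (d (ω (+ j)) (ω (+ suc j)))
    forwardSteps j j<n =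
      subst (λ t → InS± S (d (ω (+ j)) (ω t))) (+j+1≡+suc j)
        (step (+ j) (ℕ.<⇒≤ j<n) (subst (_≤ n) (ℕ.+-comm 1 j) j<n))

    backwardSteps : ∀ j → suc j ≤ n → InS± S (d (ω (ℤ.- + j)) (ω -[1+ j ]))
    backwardSteps j j<n =
      InS±-resp (⁻¹-anti-homo-\\ _ _) (InS±-⁻¹
        (subst (λ t → InS± S (d (ω -[1+ j ]) (ω t))) next≡ (step -[1+ j ] j<n next-inside)))
      where
      next≡ = -[1+j]+1≡-j j
      next-inside : ∣ -[1+ j ] ℤ.+ + 1 ∣ ≤ n
      next-inside = subst (_≤ n) (≡.sym (≡.trans (cong ∣_∣ next≡) (ℤ.∣-i∣≡∣i∣ (+ j)))) (ℕ.<⇒≤ j<n)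

    encodeWindow : ℕ → Code
    encodeWindow j = (lettersOf n (ω ∘ +_) forwardSteps j , ζ (+ j)) ,
                     (lettersOf n (ω ∘ ℤ.-_ ∘ +_) backwardSteps j , ζ (ℤ.- + j))

    -- Decoding recovers the window translated to start at the identity.
    encodeWindow-correct : CodesWindow n encodeWindow
    encodeWindow-correct =
      SnakeOn-resp decodeω≈ decodeζ≡ (SnakeOn-∙ˡ (ω (+ 0) ⁻¹) window)
      where
      decodeω≈ : ∀ i → ∣ i ∣ ≤ n → ω (+ 0) ⁻¹ ∙ ω i ≈ decodeω encodeWindow i
      decodeω≈ i ∣i∣≤n = sym (trans
        (glue-pointwise _≈_ (walk-lettersOf (ω ∘ +_) forwardSteps)
                            (walk-lettersOf (ω ∘ ℤ.-_ ∘ +_) backwardSteps) i ∣i∣≤n)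
        (reflexive (glue-halves (d (ω (+ 0)) ∘ ω) i)))
      decodeζ≡ : ∀ i → ∣ i ∣ ≤ n → ζ i ≡ decodeζ encodeWindow i
      decodeζ≡ i _ = ≡.sym (glue-halves ζ i)

  all⇒bi : ExcludedMiddle (c ⊔ ℓ) → (∀ n → SnakeOfLength S B n) → BiInfiniteSnake S B
  all⇒bi em snakes = windows⇒biInfinite (proj₂ (könig em allCodes ∈-allCodes CodesWindow
    (SnakeOn-restrict ℕ.m≤n⇒m≤1+n) CodesWindow-local codesWindow))
    where
    codesWindow : ∀ n → ∃ (CodesWindow n)
    codesWindow n with centredWindow n (snakes (suc (n ℕ.+ n)))
    ... | _ , _ , window = encodeWindow window , encodeWindow-correct window

  bi⇒one : BiInfiniteSnake S B → OneWaySnake S B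
  bi⇒one (ω , ζ , inj , step) =
    ω ∘ +_ , ζ ∘ +_ ,
    (λ i j e → ℤ.+-injective (inj _ _ e)) ,
    (λ i → subst (λ t → Step S B (ω (+ i)) (ω t) (ζ (+ i)) (ζ t)) (+j+1≡+suc i) (step (+ i)))

  one⇒interval : OneWaySnake S B → ∀ hi → IntervalSnake S B (+ 0) hi
  one⇒interval (ω , ζ , inj , step) hi = ω ∘ ∣_∣ , ζ ∘ ∣_∣ , inj' , step'
    where
    inj' : ∀ i j → + 0 ℤ.≤ i → i ℤ.≤ hi → + 0 ℤ.≤ j → j ℤ.≤ hi → ω ∣ i ∣ ≈ ω ∣ j ∣ → i ≡ j
    inj' (+ a) (+ b) _ _ _ _ e = cong +_ (inj a b e)
    step' : ∀ i → + 0 ℤ.≤ i → i ℤ.+ + 1 ℤ.≤ hi →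
            Step S B (ω ∣ i ∣) (ω ∣ i ℤ.+ + 1 ∣) (ζ ∣ i ∣) (ζ ∣ i ℤ.+ + 1 ∣)
    step' (+ a) _ _ = subst (λ t → Step S B (ω a) (ω ∣ t ∣) (ζ a) (ζ ∣ t ∣)) (≡.sym (+j+1≡+suc a)) (step a)

  one⇒all : OneWaySnake S B → ∀ n → SnakeOfLength S B n
  one⇒all snake n = + 0 , + n ℤ.- + 1 , i-1-0+1≡i (+ n) , one⇒interval snake _

open Snakes

proposition1 : {c ℓ : Level} → ExcludedMiddle (c ⊔ ℓ) → (G : Group c ℓ) →
    (S : List (Group.Carrier G)) → Generates G S →
    (k : ℕ) (B : Edges G k) → IsTilesetGraph G S B →
    (BiInfiniteSnake G S B ⇔ OneWaySnake G S B) ×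
    (OneWaySnake G S B ⇔ (∀ n → SnakeOfLength G S B n))
proposition1 em G S _ k B _ =
  mk⇔ bi⇒one (all⇒bi em ∘ one⇒all) ,
  mk⇔ one⇒all (bi⇒one ∘ all⇒bi em)
  where open SnakeTheory G S B
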